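{- Let $S$ be a saw with backbone $(v_1,\dots,v_{2k+1},v_1)$, and let $P(v_i,v_j)$ be a path of order $l$ joining $v_i$ to $v_j$ that runs along the cycle $(v_1,\dots,v_{2k+1},v_1)$ (i.e. it consists of consecutive vertices and edges of this cycle). Then: (i) if the edge $(v_1,v_{2k+1})$ does not belong to $P(v_i,v_j)$, then $P(v_i,v_j)$ has a $q$-reduction for every $q\in\left[\lceil l/2\rceil+1,\,l\right]$; (ii) if the edge $(v_1,v_{2k+1})$ belongs to $P(v_i,v_j)$, then $P(v_i,v_j)$ has a $q$-reduction for every $q\in\left[\lfloor l/2\rfloor+2,\,l\right]$. In particular, if $P(x,y)$ is a path of order $2k+1$ along the cycle $(v_1,\dots,v_{2k+1},v_1)$, then $P$ has $q$-reductions for every $q\in[k+2,2k+1]$.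
   Context: A graph $S$ with vertex set $\{v_1,\dots,v_{2k+1}\}$ ($k\geq1$) is a saw if it contains the Hamiltonian cycle $(v_1,\dots,v_{2k+1},v_1)$ (its backbone) together with the chords $(v_{2s-1},v_{2s+1})$ for every $s\in\{1,\dots,k\}$; other edges may also be present. The order of a path is its number of vertices; $[m,n]=\{m,m+1,\dots,n\}$. A reduction of an $xy$-path $P$ is an $xy$-path in $S$ all of whose vertices belong to $P$; a $q$-reduction is a reduction of order $q$. -}

module Defs where

open import Data.Nat using (ℕ; zero; suc; _+_; _*_; _<_; _≤_; ⌈_/2⌉; ⌊_/2⌋)
open import Data.Fin using (Fin; toℕ; fromℕ)
import Data.Fin
open import Data.List using (List; []; _∷_; length; head; last)
open import Data.List.Relation.Unary.Linked using (Linked)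
open import Data.List.Relation.Unary.All using (All)
open import Data.List.Relation.Unary.Unique.Propositional using (Unique)
open import Data.List.Membership.Propositional using (_∈_)
open import Data.Maybe using (Maybe; just)
open import Data.Product using (_×_; ∃-syntax)
open import Data.Sum using (_⊎_)
open import Relation.Binary.PropositionalEquality using (_≡_)
open import Relation.Nullary using (¬_)
open import Level using (0ℓ) renaming (suc to lsuc)

-- Vertices v_1, …, v_{2k+1} are represented by Fin (suc (2 * k));
-- v_{i} corresponds to the element with toℕ = i - 1.
V : ℕ → Set
V k = Fin (suc (2 * k))

vFirst : (k : ℕ) → V k
vFirst k = Data.Fin.zero

vLast : (k : ℕ) → V k
vLast k = fromℕ (2 * k)

CycAdj : (k : ℕ) → V k → V k → Set
CycAdj k u v =
  (suc (toℕ u) ≡ toℕ v) ⊎ (suc (toℕ v) ≡ toℕ u)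
  ⊎ ((toℕ u ≡ 2 * k) × (toℕ v ≡ 0)) ⊎ ((toℕ v ≡ 2 * k) × (toℕ u ≡ 0))

-- A saw on 2k+1 vertices: a (simple, undirected) graph containing the backbone cycle
-- and the chords (v_{2s-1}, v_{2s+1}), s ∈ [1,k]  (0-indexed: toℕ u = 2s-2, toℕ v = 2s).
-- Other edges may be present.
record Saw (k : ℕ) : Set₁ where
  field
    Adj      : V k → V k → Set
    sym      : ∀ {u v} → Adj u v → Adj v u
    irrefl   : ∀ {u} → ¬ Adj u u
    backbone : ∀ u v → CycAdj k u v → Adj u v
    chord    : ∀ s → 1 ≤ s → s ≤ k → ∀ u v →
               suc (suc (toℕ u)) ≡ 2 * s → toℕ v ≡ 2 * s → Adj u v

-- An xy-path (as a list of vertices) in a graph given by adjacency R: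
-- consecutive vertices adjacent, all vertices distinct, starts at x, ends at y.
-- Its order is the length of the list.
IsPath : ∀ {A : Set} → (A → A → Set) → A → A → List A → Set
IsPath R x y xs = Linked R xs × Unique xs × (head xs ≡ just x) × (last xs ≡ just y)

data HasEdge {A : Set} (a b : A) : List A → Set where
  here  : ∀ {u v xs} → ((u ≡ a × v ≡ b) ⊎ (u ≡ b × v ≡ a)) → HasEdge a b (u ∷ v ∷ xs)
  there : ∀ {u xs} → HasEdge a b xs → HasEdge a b (u ∷ xs)

IsReduction : ∀ {k} → Saw k → V k → V k → List (V k) → List (V k) → Set
IsReduction S x y xs ys = IsPath (Saw.Adj S) x y ys × All (_∈ xs) ys

HasQReduction : ∀ {k} → Saw k → V k → V k → List (V k) → ℕ → Set
HasQReduction S x y xs q = ∃[ ys ] (IsReduction S x y xs ys × length ys ≡ q)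

-- Index the vertices from 0 (v_i has index i − 1), so that the chord joining 2s − 2 and 2s
-- bypasses the odd vertex 2s − 1. Along the backbone consecutive indices have opposite parity,
-- except across the edge v₁v_{2k+1}, whose ends 0 and 2k are both even. Hence in a path along
-- the backbone each odd interior vertex can be cut out through a chord, independently of the
-- others, and cutting out d of them leaves a reduction of order l − d. Alternation makes about
-- half of the vertices odd: without the edge v₁v_{2k+1} at least ⌊l/2⌋ − 1 interior ones, and
-- since a simple path uses that edge at most once, at least ⌈l/2⌉ − 2 in any case.
module Submission where

open import Defs
open import Data.Nat using (ℕ; zero; suc; _+_; _*_; _∸_; _≤_; _<_; z≤n; s≤s; s≤s⁻¹; ⌈_/2⌉; ⌊_/2⌋)
open import Data.Nat.Properties
open import Data.Bool using (Bool; true; false; not; if_then_else_)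
open import Data.Bool.Properties using (not-involutive)
open import Data.Fin using (toℕ)
open import Data.Fin.Properties using (toℕ-injective; toℕ-fromℕ; toℕ<n)
open import Data.List using (List; []; _∷_; length; last)
open import Data.List.Relation.Unary.Linked as Linked using (Linked; []; [-]; _∷_)
open import Data.List.Relation.Unary.All as All using (_∷_)
open import Data.List.Relation.Unary.AllPairs using ([]; _∷_)
open import Data.List.Relation.Unary.Any using (here; there)
open import Data.List.Relation.Unary.Unique.Propositional using (Unique)
open import Data.List.Relation.Unary.Unique.Propositional.Properties using (Unique[x∷xs]⇒x∉xs)
open import Data.List.Membership.Propositional using (_∈_; _∉_)
open import Data.List.Relation.Binary.Sublist.Propositional using (_⊆_; []; _∷ʳ_; _∷_; ⊆-refl; lookup)
open import Data.List.Relation.Binary.Sublist.Propositional.Properties using (All-resp-⊆)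
open import Data.Product using (_×_; _,_; proj₁; proj₂; ∃-syntax)
open import Data.Sum using (_⊎_; inj₁; inj₂)
open import Data.Empty using (⊥-elim)
open import Function using (_∘_)
open import Relation.Binary.PropositionalEquality using (_≡_; _≢_; refl; sym; trans; cong; subst; module ≡-Reasoning)
open import Relation.Nullary using (¬_)

Unique-resp-⊇ : ∀ {A : Set} {xs ys : List A} → ys ⊆ xs → Unique xs → Unique ys
Unique-resp-⊇ []         []       = []
Unique-resp-⊇ (_ ∷ʳ ys⊆) (_ ∷ un) = Unique-resp-⊇ ys⊆ un
Unique-resp-⊇ (refl ∷ ys⊆) (x∉ ∷ un) = All-resp-⊆ ys⊆ x∉ ∷ Unique-resp-⊇ ys⊆ un

HasEdge-endpoints : ∀ {A : Set} {a b : A} {xs} → HasEdge a b xs → a ∈ xs × b ∈ xs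
HasEdge-endpoints (here (inj₁ (refl , refl))) = here refl , there (here refl)
HasEdge-endpoints (here (inj₂ (refl , refl))) = there (here refl) , here refl
HasEdge-endpoints (there e) = there (proj₁ (HasEdge-endpoints e)) , there (proj₂ (HasEdge-endpoints e))

isOdd : ℕ → Bool
isOdd zero    = false
isOdd (suc n) = not (isOdd n)

isOdd-2* : ∀ m → isOdd (2 * m) ≡ false
isOdd-2* zero = refl
isOdd-2* (suc m) rewrite +-suc m (m + 0) | not-involutive (isOdd (2 * m)) = isOdd-2* m

isOdd⇒suc≡2* : ∀ n → isOdd n ≡ true → ∃[ s ] suc n ≡ 2 * s
isOdd⇒suc≡2* (suc zero) _ = 1 , refl
isOdd⇒suc≡2* (suc (suc n)) odd-n rewrite not-involutive (isOdd n) with isOdd⇒suc≡2* n odd-n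
... | s , e = suc s , trans (cong (suc ∘ suc) e) (sym (*-suc 2 s))

module Bypassing {A : Set} (odd : A → Bool) where

  -- Greedy: after bypassing an odd w its successor is kept, so the shortcuts never overlap.
  bypassable : List A → ℕ
  bypassable (u ∷ w ∷ v ∷ r) = if odd w then suc (bypassable (v ∷ r)) else bypassable (w ∷ v ∷ r)
  bypassable _               = 0

  Alternating : A → A → Set
  Alternating a b = odd b ≡ not (odd a)

  alternating-sym : ∀ {a b} → Alternating a b → Alternating b a
  alternating-sym {a} alt = sym (trans (cong not alt) (not-involutive (odd a)))

  parity-step : ∀ {a b p} → odd a ≡ p → Alternating a b → odd b ≡ not p
  parity-step odd-a alt = trans alt (cong not odd-a)

  evenBit : Bool → ℕ
  evenBit false = 1
  evenBit true  = 0

  evenBit≤1 : ∀ b → evenBit b ≤ 1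
  evenBit≤1 false = s≤s z≤n
  evenBit≤1 true  = z≤n

  alternating-bound : ∀ b u r → odd u ≡ b → Linked Alternating (u ∷ r) →
                      ⌊ evenBit b + length (u ∷ r) /2⌋ ≤ suc (bypassable (u ∷ r))
  alternating-bound b u []      _ _ = ⌊n/2⌋-mono (+-monoˡ-≤ 1 (evenBit≤1 b))
  alternating-bound b u (_ ∷ []) _ _ = ⌊n/2⌋-mono (+-monoˡ-≤ 2 (evenBit≤1 b))
  alternating-bound b u (w ∷ v ∷ r) odd-u (uw ∷ _) with odd w in odd-w | parity-step odd-u uw
  alternating-bound false u (w ∷ v ∷ r) _ (_ ∷ wv ∷ alt) | true | _ =
    s≤s (alternating-bound false v r (parity-step odd-w wv) alt)
  alternating-bound true u (w ∷ v ∷ r) _ (_ ∷ alt) | false | _ =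
    alternating-bound false w (v ∷ r) odd-w alt
  alternating-bound true  _ (_ ∷ _ ∷ _) _ _ | true  | ()
  alternating-bound false _ (_ ∷ _ ∷ _) _ _ | false | ()

  module _ {R E : A → A → Set} (R⇒E : ∀ {a b} → R a b → E a b)
           (bypass : ∀ {u w v} → odd w ≡ true → R u w → R w v → u ≢ v → E u v) where

    shortcut : ∀ {u r} d → Linked R (u ∷ r) → Unique (u ∷ r) → d ≤ bypassable (u ∷ r) →
               ∃[ zs ] (zs ⊆ r × Linked E (u ∷ zs) × last (u ∷ zs) ≡ last (u ∷ r)
                        × length zs + d ≡ length r)
    shortcut zero lk _ _ = _ , ⊆-refl , Linked.map R⇒E lk , refl , +-identityʳ _
    shortcut {u} {w ∷ v ∷ r} (suc d) (uw ∷ lk) ((_ ∷ u≢v ∷ _) ∷ un) d≤c with odd w in odd-w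
    ... | true with lk | un
    ...   | wv ∷ lk′ | _ ∷ un′ with shortcut d lk′ un′ (s≤s⁻¹ d≤c)
    ...     | zs , zs⊆ , lz , same-last , len =
      v ∷ zs , w ∷ʳ (refl ∷ zs⊆) , bypass odd-w uw wv u≢v ∷ lz , same-last ,
      cong suc (trans (+-suc _ d) (cong suc len))
    shortcut {u} {w ∷ v ∷ r} (suc d) (uw ∷ lk) (_ ∷ un) d≤c | false
      with shortcut (suc d) lk un d≤c
    ... | zs , zs⊆ , lz , same-last , len =
      w ∷ zs , refl ∷ zs⊆ , R⇒E uw ∷ lz , same-last , cong suc len

    shorten : ∀ {x y xs} q → IsPath R x y xs → q ≤ length xs → length xs ≤ q + bypassable xs →
              ∃[ ys ] (IsPath E x y ys × ys ⊆ xs × length ys ≡ q)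
    shorten {xs = u ∷ r} q (lk , un , refl , last≡y) q≤n n≤q+c
      with shortcut (length (u ∷ r) ∸ q) lk un (m≤n+o⇒m∸n≤o _ q n≤q+c)
    ... | zs , zs⊆ , lz , same-last , len =
      u ∷ zs , (lz , Unique-resp-⊇ (refl ∷ zs⊆) un , refl , trans same-last last≡y) , refl ∷ zs⊆ ,
      +-cancelʳ-≡ (length (u ∷ r) ∸ q) _ q (trans (cong suc len) (sym (m+[n∸m]≡n q≤n)))

module Backbone (k : ℕ) where

  odd : V k → Bool
  odd v = isOdd (toℕ v)

  open Bypassing odd public

  Consecutive : V k → V k → Set
  Consecutive u w = suc (toℕ u) ≡ toℕ w ⊎ suc (toℕ w) ≡ toℕ u

  WrapEdge : V k → V k → Set
  WrapEdge u w = (u ≡ vFirst k × w ≡ vLast k) ⊎ (u ≡ vLast k × w ≡ vFirst k)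

  CycAdj-sym : ∀ {u w} → CycAdj k u w → CycAdj k w u
  CycAdj-sym (inj₁ e)                = inj₂ (inj₁ e)
  CycAdj-sym (inj₂ (inj₁ e))         = inj₁ e
  CycAdj-sym (inj₂ (inj₂ (inj₁ e)))  = inj₂ (inj₂ (inj₂ e))
  CycAdj-sym (inj₂ (inj₂ (inj₂ e)))  = inj₂ (inj₂ (inj₁ e))

  toℕ≡2k⇒vLast : ∀ {u : V k} → toℕ u ≡ 2 * k → u ≡ vLast k
  toℕ≡2k⇒vLast e = toℕ-injective (trans e (sym (toℕ-fromℕ (2 * k))))

  backbone-cases : ∀ {u w} → CycAdj k u w → Consecutive u w ⊎ WrapEdge u w
  backbone-cases (inj₁ e)                          = inj₁ (inj₁ e)
  backbone-cases (inj₂ (inj₁ e))                   = inj₁ (inj₂ e)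
  backbone-cases (inj₂ (inj₂ (inj₁ (u≡2k , w≡0)))) = inj₂ (inj₂ (toℕ≡2k⇒vLast u≡2k , toℕ-injective w≡0))
  backbone-cases (inj₂ (inj₂ (inj₂ (w≡2k , u≡0)))) = inj₂ (inj₁ (toℕ-injective u≡0 , toℕ≡2k⇒vLast w≡2k))

  consecutive-alternates : ∀ {u w} → Consecutive u w → Alternating u w
  consecutive-alternates (inj₁ u+1≡w) = cong isOdd (sym u+1≡w)
  consecutive-alternates {u} {w} (inj₂ w+1≡u) = alternating-sym {w} {u} (cong isOdd (sym w+1≡u))

  vLast-even : odd (vLast k) ≡ false
  vLast-even rewrite toℕ-fromℕ (2 * k) = isOdd-2* k

  wrap-ends-even : ∀ {u w} → WrapEdge u w → odd u ≡ false × odd w ≡ false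
  wrap-ends-even (inj₁ (refl , refl)) = refl , vLast-even
  wrap-ends-even (inj₂ (refl , refl)) = vLast-even , refl

  odd-neighbour : ∀ {u w} → odd w ≡ true → CycAdj k u w → Consecutive u w
  odd-neighbour odd-w uw with backbone-cases uw
  ... | inj₁ consecutive = consecutive
  ... | inj₂ wrap with trans (sym odd-w) (proj₂ (wrap-ends-even wrap))
  ...   | ()

  chord-index-bound : ∀ {v : V k} {s} → toℕ v ≡ 2 * s → s ≤ k
  chord-index-bound {v} v≡2s = *-cancelˡ-≤ 2 (s≤s⁻¹ (subst (_< suc (2 * k)) v≡2s (toℕ<n v)))

  chord-across : (S : Saw k) → ∀ {u w v} → odd w ≡ true →
                 suc (toℕ u) ≡ toℕ w → suc (toℕ w) ≡ toℕ v → Saw.Adj S u v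
  chord-across S {u} {w} {v} odd-w u+1≡w w+1≡v with isOdd⇒suc≡2* (toℕ w) odd-w
  ... | suc m , w+1≡2s =
    Saw.chord S (suc m) (s≤s z≤n) (chord-index-bound v≡2s) u v (trans (cong suc u+1≡w) w+1≡2s) v≡2s
    where
    v≡2s : toℕ v ≡ 2 * suc m
    v≡2s = trans (sym w+1≡v) w+1≡2s

  bypass-odd : (S : Saw k) → ∀ {u w v} → odd w ≡ true → CycAdj k u w → CycAdj k w v → u ≢ v →
               Saw.Adj S u v
  bypass-odd S odd-w uw wv u≢v with odd-neighbour odd-w uw | odd-neighbour odd-w (CycAdj-sym wv)
  ... | inj₁ u+1≡w | inj₂ w+1≡v = chord-across S odd-w u+1≡w w+1≡v
  ... | inj₂ w+1≡u | inj₁ v+1≡w = Saw.sym S (chord-across S odd-w v+1≡w w+1≡u)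
  ... | inj₁ u+1≡w | inj₁ v+1≡w = ⊥-elim (u≢v (toℕ-injective (suc-injective (trans u+1≡w (sym v+1≡w)))))
  ... | inj₂ w+1≡u | inj₂ w+1≡v = ⊥-elim (u≢v (toℕ-injective (trans (sym w+1≡u) w+1≡v)))

  wrapFree⇒alternating : ∀ {xs} → Linked (CycAdj k) xs → ¬ HasEdge (vFirst k) (vLast k) xs →
                         Linked Alternating xs
  wrapFree⇒alternating []  _ = []
  wrapFree⇒alternating [-] _ = [-]
  wrapFree⇒alternating (uw ∷ lk) wrap-free with backbone-cases uw
  ... | inj₁ consecutive = consecutive-alternates consecutive ∷ wrapFree⇒alternating lk (wrap-free ∘ there)
  ... | inj₂ wrap        = ⊥-elim (wrap-free (here wrap))

  wrap-not-repeated : ∀ {u w xs} → WrapEdge u w → u ∉ xs → ¬ HasEdge (vFirst k) (vLast k) xs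
  wrap-not-repeated (inj₁ (refl , _)) u∉xs e = u∉xs (proj₁ (HasEdge-endpoints e))
  wrap-not-repeated (inj₂ (refl , _)) u∉xs e = u∉xs (proj₂ (HasEdge-endpoints e))

  -- A simple path crosses the edge v₁v_{2k+1} at most once, and there both ends are even.
  path-bound : ∀ b u r → odd u ≡ b → Linked (CycAdj k) (u ∷ r) → Unique (u ∷ r) →
               ⌈ evenBit b + length (u ∷ r) /2⌉ ≤ 2 + bypassable (u ∷ r)
  path-bound b u []       _ _ _ = ≤-trans (⌈n/2⌉-mono (+-monoˡ-≤ 1 (evenBit≤1 b))) (s≤s z≤n)
  path-bound b u (_ ∷ []) _ _ _ = ⌈n/2⌉-mono (+-monoˡ-≤ 2 (evenBit≤1 b))
  path-bound b u (w ∷ v ∷ r) odd-u (uw ∷ lk) un@(_ ∷ un′) with backbone-cases uw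
  ... | inj₂ wrap with wrap-ends-even {u} {w} wrap
  ...   | even-u , even-w with trans (sym odd-u) even-u
  ...     | refl rewrite even-w =
    s≤s (alternating-bound false w (v ∷ r) even-w
          (wrapFree⇒alternating lk (wrap-not-repeated {u} {w} wrap (Unique[x∷xs]⇒x∉xs un))))
  path-bound b u (w ∷ v ∷ r) odd-u (uw ∷ lk) un | inj₁ consecutive
    with odd w in odd-w | parity-step {u} {w} odd-u (consecutive-alternates consecutive)
  path-bound false u (w ∷ v ∷ r) _ (_ ∷ wv ∷ lk) (_ ∷ _ ∷ un) | inj₁ _ | true | _ =
    s≤s (path-bound false v r (parity-step {w} {v} odd-w w-v-alternate) lk un)
    where
    w-v-alternate : Alternating w v
    w-v-alternate = alternating-sym {v} {w} (consecutive-alternates (odd-neighbour odd-w (CycAdj-sym wv)))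
  path-bound true u (w ∷ v ∷ r) _ (_ ∷ lk) (_ ∷ un) | inj₁ _ | false | _ =
    path-bound false w (v ∷ r) odd-w lk un
  path-bound true  _ (_ ∷ _ ∷ _) _ _ _ | inj₁ _ | true  | ()
  path-bound false _ (_ ∷ _ ∷ _) _ _ _ | inj₁ _ | false | ()

  wrapFree-floor-bound : ∀ {P} → Linked (CycAdj k) P → ¬ HasEdge (vFirst k) (vLast k) P →
                         ⌊ length P /2⌋ ≤ 1 + bypassable P
  wrapFree-floor-bound {[]}    _  _         = z≤n
  wrapFree-floor-bound {u ∷ r} lk wrap-free =
    ≤-trans (⌊n/2⌋-mono (m≤n+m _ (evenBit (odd u))))
            (alternating-bound (odd u) u r refl (wrapFree⇒alternating lk wrap-free))

  path-ceil-bound : ∀ {P} → Linked (CycAdj k) P → Unique P → ⌈ length P /2⌉ ≤ 2 + bypassable P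
  path-ceil-bound {[]}    _  _  = z≤n
  path-ceil-bound {u ∷ r} lk un =
    ≤-trans (⌈n/2⌉-mono (m≤n+m _ (evenBit (odd u)))) (path-bound (odd u) u r refl lk un)

  reduction : (S : Saw k) → ∀ {x y P} q → IsPath (CycAdj k) x y P →
              q ≤ length P → length P ≤ q + bypassable P → HasQReduction S x y P q
  reduction S q path q≤n n≤q+c
    with shorten (λ {a} {b} → Saw.backbone S a b) (bypass-odd S) q path q≤n n≤q+c
  ... | ys , ys-path , ys⊆P , len = ys , (ys-path , All.tabulate (lookup ys⊆P)) , len

≤-via-split : ∀ {n a b m c q} → a + b ≡ n → b ≤ m + c → a + m ≤ q → n ≤ q + c
≤-via-split {n} {a} {b} {m} {c} {q} a+b≡n b≤m+c a+m≤q = begin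
  n           ≡⟨ sym a+b≡n ⟩
  a + b       ≤⟨ +-monoʳ-≤ a b≤m+c ⟩
  a + (m + c) ≡⟨ sym (+-assoc a m c) ⟩
  a + m + c   ≤⟨ +-monoˡ-≤ c a+m≤q ⟩
  q + c       ∎
  where open ≤-Reasoning

⌊2k+1/2⌋≡k : ∀ k → ⌊ 2 * k + 1 /2⌋ ≡ k
⌊2k+1/2⌋≡k k = begin
  ⌊ 2 * k + 1 /2⌋ ≡⟨ cong ⌊_/2⌋ (trans (+-comm (2 * k) 1) (cong (suc ∘ (k +_)) (+-identityʳ k))) ⟩
  ⌈ k + k /2⌉     ≡⟨ sym (n≡⌈n+n/2⌉ k) ⟩
  k               ∎
  where open ≡-Reasoning

lemma7 : (k : ℕ) → 1 ≤ k → (S : Saw k) → (x y : V k) → (P : List (V k)) →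
    IsPath (CycAdj k) x y P →
    (¬ HasEdge (vFirst k) (vLast k) P →
       ∀ q → ⌈ length P /2⌉ + 1 ≤ q → q ≤ length P → HasQReduction S x y P q)
    × (HasEdge (vFirst k) (vLast k) P →
       ∀ q → ⌊ length P /2⌋ + 2 ≤ q → q ≤ length P → HasQReduction S x y P q)
    × (length P ≡ 2 * k + 1 →
       ∀ q → k + 2 ≤ q → q ≤ 2 * k + 1 → HasQReduction S x y P q)
lemma7 k _ S x y P path@(linked , unique , _) =
  reduction-above-⌈n/2⌉+1 , (λ _ → reduction-above-⌊n/2⌋+2) ,
  λ n≡2k+1 q lo hi → reduction-above-⌊n/2⌋+2 q
    (≤-trans (≤-reflexive (cong (_+ 2) (trans (cong ⌊_/2⌋ n≡2k+1) (⌊2k+1/2⌋≡k k)))) lo)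
    (≤-trans hi (≤-reflexive (sym n≡2k+1)))
  where
  open Backbone k
  n = length P

  reduction-above-⌈n/2⌉+1 : ¬ HasEdge (vFirst k) (vLast k) P →
                            ∀ q → ⌈ n /2⌉ + 1 ≤ q → q ≤ n → HasQReduction S x y P q
  reduction-above-⌈n/2⌉+1 wrap-free q lo hi =
    reduction S q path hi (≤-via-split (trans (+-comm ⌈ n /2⌉ ⌊ n /2⌋) (⌊n/2⌋+⌈n/2⌉≡n n))
                                       (wrapFree-floor-bound linked wrap-free) lo)

  reduction-above-⌊n/2⌋+2 : ∀ q → ⌊ n /2⌋ + 2 ≤ q → q ≤ n → HasQReduction S x y P q
  reduction-above-⌊n/2⌋+2 q lo hi =
    reduction S q path hi (≤-via-split (⌊n/2⌋+⌈n/2⌉≡n n) (path-ceil-bound linked unique) lo)
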